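{- Let $n>3$ and $k$ be integers with $n+1\leq k<\frac{n(n-1)}{2}$, and let $i_0=i_0(n,k)$ be the greatest integer such that $k-1\geq n+(n-1)+\cdots+(n-i_0)$. Then $$\frac{1}{n e^n}\Gamma(n-i_0)\leq \mathcal{C}(n,k)\leq 2^n\,\Gamma(n-i_0).$$
   Context: $\Gamma$ is Euler's Gamma function. For a permutation $\sigma=a_1\cdots a_n$ of $\{1,\dots,n\}$, position $j$ is a record position if $a_i<a_j$ for all $i<j$. $\mathcal{C}(n,k)$ denotes the number of permutations of $\{1,\dots,n\}$ whose record positions sum to $k$. -}

module Defs where

open import Data.Nat using (ℕ; zero; suc; _+_; _*_; _∸_; _^_; _≤_; _<_; _<ᵇ_; _!)
open import Data.Nat.Properties using (_!≢0)
open import Data.Nat.DivMod using (_/_)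
open import Data.Bool using (Bool; true; false; _∧_; not; if_then_else_)
open import Data.List using (List; []; _∷_; length; filter; map; concatMap; upTo; all)
open import Data.Nat.ListAction using (sum)
open import Data.Product using (_×_; _,_)
open import Relation.Binary.PropositionalEquality using (_≡_)
open import Relation.Nullary.Decidable using (does)
import Data.Nat as ℕ

seqs : ℕ → ℕ → List (List ℕ)
seqs n zero = [] ∷ []
seqs n (suc len) = concatMap (λ a → map (a ∷_) (seqs n len)) (map suc (upTo n))

distinct : List ℕ → Bool
distinct [] = true
distinct (a ∷ as) = all (λ b → not (a ℕ.≡ᵇ b)) as ∧ distinct as

perms : ℕ → List (List ℕ)
perms n = filter (λ σ → Data.Bool._≟_ (distinct σ) true) (seqs n n)
  where import Data.Bool

-- sum of record positions (1-indexed): position j is a record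
-- iff aᵢ < aⱼ for all i < j.  'prefix' holds a₁,…,a_{j-1}, 'pos' = j.
recSumAux : ℕ → List ℕ → List ℕ → ℕ
recSumAux pos prefix [] = 0
recSumAux pos prefix (a ∷ as) =
  (if all (λ x → x <ᵇ a) prefix then pos else 0)
  + recSumAux (suc pos) (a ∷ prefix) as

recordPosSum : List ℕ → ℕ
recordPosSum σ = recSumAux 1 [] σ

𝒞 : ℕ → ℕ → ℕ
𝒞 n k = length (filter (λ σ → ℕ._≟_ (recordPosSum σ) k) (perms n))

S : ℕ → ℕ → ℕ
S n zero = n
S n (suc i) = S n i + (n ∸ suc i)

-- exp partial sum, scaled by m!:  m! · Σ_{j=0}^{m} xʲ / j!  (= Σ xʲ·(m!/j!), exact in ℕ)
expPartialScaled : ℕ → ℕ → ℕ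
expPartialScaled x m = sum (map (λ j → x ^ j * ((m !) / (j !)) {{j !≢0}}) (upTo (suc m)))

{-# OPTIONS --safe #-}
-- Removing the last entry of a permutation gives 𝒞(m+1,k) = 𝒞(m,k−m−1) + m·𝒞(m,k), since
-- position m+1 is a record exactly when it holds the largest value.  In terms of the sum
-- w = n(n+1)/2 − k of the non-record positions, 𝒞(n,k) is the coefficient of q^w in
-- ∏_{j≤n} (1 + (j−1)q^j), i.e. a sum over sets T ⊆ {2,…,n} with ΣT = w of ∏_{j∈T} (j−1).
-- With c = n − i₀ − 1 the choice of i₀ says exactly that tri (c−1) ≤ w < tri c, where
-- tri c = 1 + ⋯ + c.  There are at most 2ⁿ sets T and every product is at most c!; the
-- induction proving this needs the finer bound p!·(y+1) for w < tri p + y, y ≤ p, which grows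
-- linearly from p! to (p+1)! across each window.  Conversely the sets {2,…,c}, {2,…,c}∖{r}
-- and {3,…,c−1,c+1} realise every w of the window with product at least (c−2)!, so
-- c! ≤ n(n+1)·𝒞(n,k): the truncation of e^n after its linear term already suffices.

module Submission where

open import Defs
open import Data.Bool using (Bool; true; false; _∧_; not; if_then_else_; T)
open import Data.Bool.Properties using (T-∧; ∧-assoc; ∧-comm; ∧-identityʳ; ∧-zeroʳ; ∧-commutativeMonoid)
import Data.Bool as Bool
open import Data.List using (List; []; _∷_; _++_; length; map; concatMap; filter; upTo; all; applyUpTo)
open import Data.List.Properties using (length-map; length-applyUpTo; map-upTo)
open import Data.List.Membership.Propositional.Properties using (∈-applyUpTo⁻)
open import Data.List.Membership.Propositional using (_∈_; _∉_)
open import Data.List.Relation.Unary.Any using (here; there)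
open import Data.List.Relation.Unary.All using (All)
import Data.List.Relation.Unary.All as All
open import Data.List.Relation.Unary.All.Properties using (all⁺; all⁻; all-anti-mono)
open import Data.List.Relation.Binary.Subset.Propositional using (_⊆_)
open import Data.List.Extrema.Nat using (max; ⊥≤max; xs≤max; max≤v⁺; argmax-sel)
open import Data.Nat using (ℕ; zero; suc; z<s; _≤′_; ≤′-refl; ≤′-step; _+_; _*_; _∸_; _^_; _≤_; _<_; _≤ᵇ_; _<ᵇ_; _≡ᵇ_; _!; z≤n; s≤s; _≟_; _≤?_; _<?_)
open import Data.Nat.Properties
open import Data.Nat.Divisibility using (∣⇒≤; m≤n⇒m!∣n!)
open import Data.Nat.Tactic.RingSolver using (solve-∀; solve)
open import Data.Product using (_×_; ∃; _,_; proj₁; proj₂)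
open import Data.Sum using (inj₁; inj₂)
open import Data.Empty using (⊥-elim)
open import Function using (_∘_; Equivalence)
open import Relation.Binary.PropositionalEquality
open import Relation.Nullary using (yes; no)
open import Relation.Nullary.Decidable using (does)
open import Relation.Unary using (Pred; Decidable)
open import Level using (0ℓ)
open import Data.List.Membership.DecPropositional _≟_ using (_∈?_)

open import Algebra.Bundles using (CommutativeMonoid)
open import Algebra.Properties.CommutativeSemigroup +-commutativeSemigroup using (interchange; x∙yz≈y∙xz; x∙yz≈xz∙y)
open import Algebra.Properties.CommutativeSemigroup *-commutativeSemigroup using () renaming (x∙yz≈y∙xz to *-x∙yz≈y∙xz)
open import Algebra.Properties.CommutativeSemigroup (CommutativeMonoid.commutativeSemigroup ∧-commutativeMonoid) using () renaming (interchange to ∧-interchange)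

module _ {A : Set} where

  sumOver : (A → ℕ) → List A → ℕ
  sumOver f []       = 0
  sumOver f (x ∷ xs) = f x + sumOver f xs

  count : (A → Bool) → List A → ℕ
  count p = sumOver (λ x → if p x then 1 else 0)

  sumOver-cong : ∀ {f g} xs → (∀ x → x ∈ xs → f x ≡ g x) → sumOver f xs ≡ sumOver g xs
  sumOver-cong []       eq = refl
  sumOver-cong (x ∷ xs) eq = cong₂ _+_ (eq x (here refl)) (sumOver-cong xs (λ y → eq y ∘ there))

  count-cong : ∀ {p q} xs → (∀ x → x ∈ xs → p x ≡ q x) → count p xs ≡ count q xs
  count-cong xs eq = sumOver-cong xs (λ x x∈xs → cong (λ b → if b then 1 else 0) (eq x x∈xs))

  sumOver-zero : ∀ xs → sumOver (λ _ → 0) xs ≡ 0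
  sumOver-zero []       = refl
  sumOver-zero (x ∷ xs) = sumOver-zero xs

  sumOver-++ : ∀ f xs ys → sumOver f (xs ++ ys) ≡ sumOver f xs + sumOver f ys
  sumOver-++ f []       ys = refl
  sumOver-++ f (x ∷ xs) ys = trans (cong (f x +_) (sumOver-++ f xs ys)) (sym (+-assoc (f x) _ _))

  sumOver-+ : ∀ f g xs → sumOver (λ x → f x + g x) xs ≡ sumOver f xs + sumOver g xs
  sumOver-+ f g []       = refl
  sumOver-+ f g (x ∷ xs) = trans (cong (f x + g x +_) (sumOver-+ f g xs)) (interchange (f x) (g x) _ _)

module _ {A B : Set} where

  sumOver-map : ∀ f (g : A → B) xs → sumOver f (map g xs) ≡ sumOver (f ∘ g) xs
  sumOver-map f g []       = refl
  sumOver-map f g (x ∷ xs) = cong (f (g x) +_) (sumOver-map f g xs)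

  sumOver-concatMap : ∀ f (g : A → List B) xs → sumOver f (concatMap g xs) ≡ sumOver (sumOver f ∘ g) xs
  sumOver-concatMap f g []       = refl
  sumOver-concatMap f g (x ∷ xs) =
    trans (sumOver-++ f (g x) (concatMap g xs)) (cong (sumOver f (g x) +_) (sumOver-concatMap f g xs))

  sumOver-swap : ∀ (f : A → B → ℕ) xs ys →
                 sumOver (λ x → sumOver (f x) ys) xs ≡ sumOver (λ y → sumOver (λ x → f x y) xs) ys
  sumOver-swap f []       ys = sym (sumOver-zero ys)
  sumOver-swap f (x ∷ xs) ys =
    trans (cong (sumOver (f x) ys +_) (sumOver-swap f xs ys)) (sym (sumOver-+ (f x) _ ys))

module _ {A : Set} where

  words : List A → ℕ → List (List A)
  words V zero    = [] ∷ []
  words V (suc l) = concatMap (λ a → map (a ∷_) (words V l)) V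

  sumOver-words-∷ : ∀ f V l → sumOver f (words V (suc l)) ≡ sumOver (λ a → sumOver (f ∘ (a ∷_)) (words V l)) V
  sumOver-words-∷ f V l = trans (sumOver-concatMap f _ V) (sumOver-cong V (λ a _ → sumOver-map f (a ∷_) (words V l)))

  sumOver-words-∷ʳ : ∀ f V l → sumOver f (words V (suc l)) ≡ sumOver (λ a → sumOver (λ τ → f (τ ++ a ∷ [])) (words V l)) V
  sumOver-words-∷ʳ f V zero    = sumOver-words-∷ f V zero
  sumOver-words-∷ʳ f V (suc l) = begin
      sumOver f (words V (suc (suc l)))
    ≡⟨ sumOver-words-∷ f V (suc l) ⟩
      sumOver (λ b → sumOver (λ σ → f (b ∷ σ)) (words V (suc l))) V
    ≡⟨ sumOver-cong V (λ b _ → sumOver-words-∷ʳ (f ∘ (b ∷_)) V l) ⟩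
      sumOver (λ b → sumOver (λ a → sumOver (λ τ → f (b ∷ τ ++ a ∷ [])) (words V l)) V) V
    ≡⟨ sumOver-swap (λ b a → sumOver (λ τ → f (b ∷ τ ++ a ∷ [])) (words V l)) V V ⟩
      sumOver (λ a → sumOver (λ b → sumOver (λ τ → f (b ∷ τ ++ a ∷ [])) (words V l)) V) V
    ≡⟨ sumOver-cong V (λ a _ → sumOver-words-∷ (λ σ → f (σ ++ a ∷ [])) V l) ⟨
      sumOver (λ a → sumOver (λ τ → f (τ ++ a ∷ [])) (words V (suc l))) V
    ∎
    where open ≡-Reasoning

  sumOver-words-cong : ∀ {f g} V l → (∀ σ → All (_∈ V) σ → length σ ≡ l → f σ ≡ g σ) →
                       sumOver f (words V l) ≡ sumOver g (words V l)
  sumOver-words-cong V zero    eq = cong (_+ 0) (eq [] All.[] refl)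
  sumOver-words-cong {f} {g} V (suc l) eq = begin
      sumOver f (words V (suc l))
    ≡⟨ sumOver-words-∷ f V l ⟩
      sumOver (λ a → sumOver (f ∘ (a ∷_)) (words V l)) V
    ≡⟨ sumOver-cong V (λ a a∈V → sumOver-words-cong V l (λ σ σ⊆V ∣σ∣ → eq (a ∷ σ) (a∈V All.∷ σ⊆V) (cong suc ∣σ∣))) ⟩
      sumOver (λ a → sumOver (g ∘ (a ∷_)) (words V l)) V
    ≡⟨ sumOver-words-∷ g V l ⟨
      sumOver g (words V (suc l))
    ∎
    where open ≡-Reasoning

count-none : ∀ {A : Set} (p : A → Bool) xs → (∀ x → x ∈ xs → p x ≡ false) → count p xs ≡ 0
count-none p xs none = trans (count-cong xs none) (sumOver-zero xs)

sumOver-if-none : ∀ {A : Set} (p : A → Bool) X Y xs → count p xs ≡ 0 →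
                  sumOver (λ a → if p a then X else Y) xs ≡ length xs * Y
sumOver-if-none p X Y []       _ = refl
sumOver-if-none p X Y (x ∷ xs) none with p x
... | false = cong (Y +_) (sumOver-if-none p X Y xs none)

sumOver-if-one : ∀ {A : Set} (p : A → Bool) X Y xs → count p xs ≡ 1 →
                 sumOver (λ a → if p a then X else Y) xs + Y ≡ X + length xs * Y
sumOver-if-one p X Y (x ∷ xs) one with p x
... | true  = begin
    X + sumOver _ xs + Y   ≡⟨ cong (λ s → X + s + Y) (sumOver-if-none p X Y xs (suc-injective one)) ⟩
    X + length xs * Y + Y  ≡⟨ +-assoc X _ Y ⟩
    X + (length xs * Y + Y) ≡⟨ cong (X +_) (+-comm _ Y) ⟩
    X + (Y + length xs * Y) ∎
  where open ≡-Reasoning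
... | false = begin
    Y + sumOver _ xs + Y    ≡⟨ +-assoc Y _ Y ⟩
    Y + (sumOver _ xs + Y)  ≡⟨ cong (Y +_) (sumOver-if-one p X Y xs one) ⟩
    Y + (X + length xs * Y) ≡⟨ x∙yz≈y∙xz Y X _ ⟩
    X + (Y + length xs * Y) ∎
  where open ≡-Reasoning

T-ext : ∀ {x y} → (T x → T y) → (T y → T x) → x ≡ y
T-ext {false} {false} _ _ = refl
T-ext {false} {true}  _ g = ⊥-elim (g _)
T-ext {true}  {false} f _ = ⊥-elim (f _)
T-ext {true}  {true}  _ _ = refl

T-≡ᵇ-refl : ∀ a → T (a ≡ᵇ a)
T-≡ᵇ-refl a = ≡⇒≡ᵇ a a refl

≡ᵇ-true⇒≡ : ∀ a {b} → (a ≡ᵇ b) ≡ true → a ≡ b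
≡ᵇ-true⇒≡ a {b} eq = ≡ᵇ⇒≡ a b (subst T (sym eq) _)

≡ᵇ-false⇒≢ : ∀ a {b} → (a ≡ᵇ b) ≡ false → a ≢ b
≡ᵇ-false⇒≢ a eq refl = subst T eq (T-≡ᵇ-refl a)

≡ᵇ-sym : ∀ a b → (a ≡ᵇ b) ≡ (b ≡ᵇ a)
≡ᵇ-sym a b = T-ext (λ h → ≡⇒≡ᵇ b a (sym (≡ᵇ⇒≡ a b h))) (λ h → ≡⇒≡ᵇ a b (sym (≡ᵇ⇒≡ b a h)))

if-∧ : ∀ x y → (if x ∧ y then 1 else 0) ≡ (if x then (if y then 1 else 0) else 0)
if-∧ true  y = refl
if-∧ false y = refl

notElem : ℕ → List ℕ → Bool
notElem a = all (λ b → not (a ≡ᵇ b))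

remove : ℕ → List ℕ → List ℕ
remove a []       = []
remove a (x ∷ xs) = if a ≡ᵇ x then remove a xs else x ∷ remove a xs

notElem⇒∉ : ∀ a {σ} → T (notElem a σ) → a ∉ σ
notElem⇒∉ a {σ} fresh a∈σ with a ≡ᵇ a | T-≡ᵇ-refl a | All.lookup (all⁺ _ σ fresh) a∈σ
... | true | _ | ()

∉⇒notElem : ∀ a σ → a ∉ σ → T (notElem a σ)
∉⇒notElem a σ a∉σ = all⁻ _ (All.tabulate λ {b} b∈σ → different b b∈σ)
  where
  different : ∀ b → b ∈ σ → T (not (a ≡ᵇ b))
  different b b∈σ with a ≡ᵇ b in eq
  ... | false = _
  ... | true  = a∉σ (subst (_∈ σ) (sym (≡ᵇ-true⇒≡ a eq)) b∈σ)

∈-remove : ∀ {a x} V → x ∈ V → x ≢ a → x ∈ remove a V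
∈-remove {a} (y ∷ V) x∈V x≢a with a ≡ᵇ y in eq | x∈V
... | true  | here refl = ⊥-elim (x≢a (sym (≡ᵇ-true⇒≡ a eq)))
... | true  | there x∈V′ = ∈-remove V x∈V′ x≢a
... | false | here refl = here refl
... | false | there x∈V′ = there (∈-remove V x∈V′ x≢a)

remove-⊆ : ∀ {a} V → remove a V ⊆ V
remove-⊆ {a} (y ∷ V) x∈ with a ≡ᵇ y
... | true = there (remove-⊆ V x∈)
remove-⊆ {a} (y ∷ V) (here refl)  | false = here refl
remove-⊆ {a} (y ∷ V) (there x∈)  | false = there (remove-⊆ V x∈)

∉-remove : ∀ {a} V → a ∉ remove a V
∉-remove {a} (y ∷ V) a∈ with a ≡ᵇ y in eq
... | true = ∉-remove V a∈
∉-remove {a} (y ∷ V) (here refl)  | false = ≡ᵇ-false⇒≢ a eq refl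
∉-remove {a} (y ∷ V) (there a∈)  | false = ∉-remove V a∈

length-remove-≤ : ∀ a V → length (remove a V) ≤ length V
length-remove-≤ a [] = z≤n
length-remove-≤ a (x ∷ V) with a ≡ᵇ x
... | true  = m≤n⇒m≤1+n (length-remove-≤ a V)
... | false = s≤s (length-remove-≤ a V)

length-remove-< : ∀ {a} V → a ∈ V → length (remove a V) < length V
length-remove-< {a} (x ∷ V) a∈V with a ≡ᵇ x in eq | a∈V
... | true  | _ = s≤s (length-remove-≤ a V)
... | false | here refl = ⊥-elim (≡ᵇ-false⇒≢ a eq refl)
... | false | there a∈V′ = s≤s (length-remove-< V a∈V′)

remove-distinct : ∀ a V → T (distinct V) → T (distinct (remove a V))
remove-distinct a [] _ = _
remove-distinct a (x ∷ V) dist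
  with freshx , distV ← Equivalence.to T-∧ dist
  with a ≡ᵇ x
... | true  = remove-distinct a V distV
... | false = Equivalence.from T-∧
  (∉⇒notElem x (remove a V) (notElem⇒∉ x freshx ∘ remove-⊆ V) , remove-distinct a V distV)

sumOver-remove : ∀ a (h : ℕ → ℕ) V → sumOver (λ b → if a ≡ᵇ b then 0 else h b) V ≡ sumOver h (remove a V)
sumOver-remove a h [] = refl
sumOver-remove a h (x ∷ V) with a ≡ᵇ x
... | true  = sumOver-remove a h V
... | false = cong (h x +_) (sumOver-remove a h V)

distinct⇒length≤ : ∀ τ {W} → T (distinct τ) → τ ⊆ W → length τ ≤ length W
distinct⇒length≤ [] _ _ = z≤n
distinct⇒length≤ (t ∷ τ) {W} dist τ⊆W
  with t∉τ , distτ ← Equivalence.to T-∧ dist =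
  ≤-trans (s≤s (distinct⇒length≤ τ distτ τ⊆W∖t)) (length-remove-< W (τ⊆W (here refl)))
  where
  τ⊆W∖t : τ ⊆ remove t W
  τ⊆W∖t x∈τ = ∈-remove W (τ⊆W (there x∈τ)) λ { refl → notElem⇒∉ t t∉τ x∈τ }

distinct-⊆⇒⊇ : ∀ τ {W} → T (distinct τ) → τ ⊆ W → length τ ≡ length W → W ⊆ τ
distinct-⊆⇒⊇ τ {W} dist τ⊆W ∣τ∣≡∣W∣ {w} w∈W with w ∈? τ
... | yes w∈τ = w∈τ
... | no  w∉τ = ⊥-elim (<-irrefl ∣τ∣≡∣W∣ (≤-<-trans (distinct⇒length≤ τ dist τ⊆W∖w) (length-remove-< W w∈W)))
  where
  τ⊆W∖w : τ ⊆ remove w W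
  τ⊆W∖w x∈τ = ∈-remove W (τ⊆W x∈τ) λ { refl → w∉τ x∈τ }

length-remove-distinct : ∀ {a} V → T (distinct V) → a ∈ V → suc (length (remove a V)) ≡ length V
length-remove-distinct {a} V dist a∈V = ≤-antisym (length-remove-< V a∈V) (distinct⇒length≤ V dist V⊆a∷W)
  where
  V⊆a∷W : V ⊆ a ∷ remove a V
  V⊆a∷W {x} x∈V with x ≟ a
  ... | yes refl = here refl
  ... | no x≢a   = there (∈-remove V x∈V x≢a)

all-⊆⊇ : ∀ (p : ℕ → Bool) {xs ys} → xs ⊆ ys → ys ⊆ xs → all p xs ≡ all p ys
all-⊆⊇ p xs⊆ys ys⊆xs = T-ext (all-anti-mono p ys⊆xs) (all-anti-mono p xs⊆ys)

allBelow : ℕ → List ℕ → Bool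
allBelow a = all (_<ᵇ a)

count-≡ᵇ : ∀ M V → T (distinct V) → M ∈ V → count (M ≡ᵇ_) V ≡ 1
count-≡ᵇ M (x ∷ V) dist M∈V
  with freshx , distV ← Equivalence.to T-∧ dist
  with M ≡ᵇ x in eq | M∈V
... | true  | _ = cong suc (count-none _ V λ y y∈V → M≢y y y∈V)
  where
  M≢y : ∀ y → y ∈ V → (M ≡ᵇ y) ≡ false
  M≢y y y∈V with M ≡ᵇ y in eq′
  ... | false = refl
  ... | true  = ⊥-elim (notElem⇒∉ x freshx (subst (_∈ V) (trans (sym (≡ᵇ-true⇒≡ M eq′)) (≡ᵇ-true⇒≡ M eq)) y∈V))
... | false | here refl = ⊥-elim (≡ᵇ-false⇒≢ M eq refl)
... | false | there M∈V′ = count-≡ᵇ M V distV M∈V′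

allBelow-remove : ∀ x V {a} → a ∈ x ∷ V → allBelow a (remove a (x ∷ V)) ≡ (max x V ≡ᵇ a)
allBelow-remove x V {a} a∈ = T-ext isMax isBelow
  where
  M = max x V
  ≤M : All (_≤ M) (x ∷ V)
  ≤M = ⊥≤max x V All.∷ xs≤max x V
  isMax : T (allBelow a (remove a (x ∷ V))) → T (M ≡ᵇ a)
  isMax below = ≡⇒≡ᵇ M a (≤-antisym (max≤v⁺ (≤a (here refl)) (All.tabulate (≤a ∘ there))) (All.lookup ≤M a∈))
    where
    ≤a : ∀ {y} → y ∈ x ∷ V → y ≤ a
    ≤a {y} y∈ with y ≟ a
    ... | yes refl = ≤-refl
    ... | no y≢a   = <⇒≤ (<ᵇ⇒< y a (All.lookup (all⁺ _ _ below) (∈-remove (x ∷ V) y∈ y≢a)))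
  isBelow : T (M ≡ᵇ a) → T (allBelow a (remove a (x ∷ V)))
  isBelow M≡a = all⁻ _ (All.tabulate λ {y} y∈ → <⇒<ᵇ (≤∧≢⇒<
    (subst (y ≤_) (≡ᵇ⇒≡ M a M≡a) (All.lookup ≤M (remove-⊆ (x ∷ V) y∈)))
    λ { refl → ∉-remove (x ∷ V) y∈ }))

max∈ : ∀ x V → max x V ∈ x ∷ V
max∈ x V with argmax-sel (λ y → y) x V
... | inj₁ M≡x = here M≡x
... | inj₂ M∈V = there M∈V

count-maximal : ∀ x V → T (distinct (x ∷ V)) → count (λ a → allBelow a (remove a (x ∷ V))) (x ∷ V) ≡ 1
count-maximal x V dist =
  trans (count-cong (x ∷ V) (λ a a∈ → allBelow-remove x V a∈)) (count-≡ᵇ (max x V) (x ∷ V) dist (max∈ x V))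

all-∷ʳ : ∀ (p : ℕ → Bool) τ a → all p (τ ++ a ∷ []) ≡ all p τ ∧ p a
all-∷ʳ p []      a = ∧-identityʳ (p a)
all-∷ʳ p (x ∷ τ) a = trans (cong (p x ∧_) (all-∷ʳ p τ a)) (sym (∧-assoc (p x) (all p τ) (p a)))

distinct-∷ʳ : ∀ τ a → distinct (τ ++ a ∷ []) ≡ notElem a τ ∧ distinct τ
distinct-∷ʳ []      a = refl
distinct-∷ʳ (b ∷ τ) a = begin
    notElem b (τ ++ a ∷ []) ∧ distinct (τ ++ a ∷ [])
  ≡⟨ cong₂ _∧_ (all-∷ʳ (λ c → not (b ≡ᵇ c)) τ a) (distinct-∷ʳ τ a) ⟩
    (notElem b τ ∧ not (b ≡ᵇ a)) ∧ (notElem a τ ∧ distinct τ)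
  ≡⟨ cong (λ c → (notElem b τ ∧ not c) ∧ (notElem a τ ∧ distinct τ)) (≡ᵇ-sym b a) ⟩
    (notElem b τ ∧ not (a ≡ᵇ b)) ∧ (notElem a τ ∧ distinct τ)
  ≡⟨ cong (_∧ (notElem a τ ∧ distinct τ)) (∧-comm (notElem b τ) _) ⟩
    (not (a ≡ᵇ b) ∧ notElem b τ) ∧ (notElem a τ ∧ distinct τ)
  ≡⟨ ∧-interchange (not (a ≡ᵇ b)) (notElem b τ) (notElem a τ) (distinct τ) ⟩
    (not (a ≡ᵇ b) ∧ notElem a τ) ∧ (notElem b τ ∧ distinct τ)
  ∎
  where open ≡-Reasoning

recSumAux-∷ʳ : ∀ pos pre τ a → recSumAux pos pre (τ ++ a ∷ []) ≡
               recSumAux pos pre τ + (if allBelow a pre ∧ allBelow a τ then pos + length τ else 0)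
recSumAux-∷ʳ pos pre []      a with allBelow a pre
... | true  = refl
... | false = refl
recSumAux-∷ʳ pos pre (b ∷ τ) a = begin
    c + recSumAux (suc pos) (b ∷ pre) (τ ++ a ∷ [])
  ≡⟨ cong (c +_) (recSumAux-∷ʳ (suc pos) (b ∷ pre) τ a) ⟩
    c + (r + (if ((b <ᵇ a) ∧ allBelow a pre) ∧ allBelow a τ then suc pos + length τ else 0))
  ≡⟨ sym (+-assoc c r _) ⟩
    c + r + (if ((b <ᵇ a) ∧ allBelow a pre) ∧ allBelow a τ then suc pos + length τ else 0)
  ≡⟨ cong (c + r +_) (cong₂ (λ cond n → if cond then n else 0) reorder (sym (+-suc pos (length τ)))) ⟩
    c + r + (if allBelow a pre ∧ ((b <ᵇ a) ∧ allBelow a τ) then pos + suc (length τ) else 0)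
  ∎
  where
  open ≡-Reasoning
  c = if allBelow b pre then pos else 0
  r = recSumAux (suc pos) (b ∷ pre) τ
  reorder : ((b <ᵇ a) ∧ allBelow a pre) ∧ allBelow a τ ≡ allBelow a pre ∧ ((b <ᵇ a) ∧ allBelow a τ)
  reorder = trans (cong (_∧ allBelow a τ) (∧-comm (b <ᵇ a) _)) (∧-assoc (allBelow a pre) _ _)

recordBonus : ℕ → List ℕ → ℕ
recordBonus a τ = if allBelow a τ then suc (length τ) else 0

recordPosSum-∷ʳ : ∀ τ a → recordPosSum (τ ++ a ∷ []) ≡ recordPosSum τ + recordBonus a τ
recordPosSum-∷ʳ τ a = recSumAux-∷ʳ 1 [] τ a

recordBonus-⊆ : ∀ a {τ W} → T (distinct τ) → All (_∈ W) τ → length τ ≡ length W → recordBonus a τ ≡ recordBonus a W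
recordBonus-⊆ a {τ} {W} dist τ⊆W ∣τ∣≡∣W∣ =
  cong₂ (λ below l → if below then suc l else 0) (all-⊆⊇ (_<ᵇ a) (All.lookup τ⊆W) W⊆τ) ∣τ∣≡∣W∣
  where
  W⊆τ : W ⊆ τ
  W⊆τ = distinct-⊆⇒⊇ τ dist (All.lookup τ⊆W) ∣τ∣≡∣W∣

sumOver-words-avoiding : ∀ a V l (f : List ℕ → ℕ) →
  sumOver (λ σ → if notElem a σ then f σ else 0) (words V l) ≡ sumOver f (words (remove a V) l)
sumOver-words-avoiding a V zero    f = refl
sumOver-words-avoiding a V (suc l) f = begin
    sumOver (λ σ → if notElem a σ then f σ else 0) (words V (suc l))
  ≡⟨ sumOver-words-∷ _ V l ⟩
    sumOver (λ b → sumOver (λ σ → if not (a ≡ᵇ b) ∧ notElem a σ then f (b ∷ σ) else 0) (words V l)) V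
  ≡⟨ sumOver-cong V (λ b _ → pull (a ≡ᵇ b) b) ⟩
    sumOver (λ b → if a ≡ᵇ b then 0 else sumOver (λ σ → if notElem a σ then f (b ∷ σ) else 0) (words V l)) V
  ≡⟨ sumOver-cong V (λ b _ → cong (λ s → if a ≡ᵇ b then 0 else s) (sumOver-words-avoiding a V l (f ∘ (b ∷_)))) ⟩
    sumOver (λ b → if a ≡ᵇ b then 0 else sumOver (f ∘ (b ∷_)) (words (remove a V) l)) V
  ≡⟨ sumOver-remove a _ V ⟩
    sumOver (λ b → sumOver (f ∘ (b ∷_)) (words (remove a V) l)) (remove a V)
  ≡⟨ sumOver-words-∷ f (remove a V) l ⟨
    sumOver f (words (remove a V) (suc l))
  ∎
  where
  open ≡-Reasoning
  pull : ∀ c b → sumOver (λ σ → if not c ∧ notElem a σ then f (b ∷ σ) else 0) (words V l) ≡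
                 (if c then 0 else sumOver (λ σ → if notElem a σ then f (b ∷ σ) else 0) (words V l))
  pull true  b = sumOver-zero (words V l)
  pull false b = refl

-- The recurrence for 𝒞

-- The last entry is a record, at position m + 1, for exactly one of the m + 1 possible values.
recordCount : ℕ → ℕ → ℕ
recordCount zero    zero    = 1
recordCount zero    (suc k) = 0
recordCount (suc m) k = (if suc m ≤ᵇ k then recordCount m (k ∸ suc m) else 0) + m * recordCount m k

hasRecordSum : ℕ → List ℕ → Bool
hasRecordSum k σ = distinct σ ∧ (recordPosSum σ ≡ᵇ k)

if-≤ᵇ-yes : ∀ {A : Set} {m n} {x y : A} → m ≤ n → (if m ≤ᵇ n then x else y) ≡ x
if-≤ᵇ-yes {m = m} {n} m≤n with m ≤ᵇ n | ≤⇒≤ᵇ m≤n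
... | true | _ = refl

if-≤ᵇ-no : ∀ {A : Set} {m n} {x y : A} → n < m → (if m ≤ᵇ n then x else y) ≡ y
if-≤ᵇ-no {m = m} {n} n<m with m ≤ᵇ n in eq
... | false = refl
... | true  = ⊥-elim (<⇒≱ n<m (≤ᵇ⇒≤ m n (subst T (sym eq) _)))

if-≤ᵇ-≤ : ∀ m n x → (if m ≤ᵇ n then x else 0) ≤ x
if-≤ᵇ-≤ m n x with m ≤ᵇ n
... | true  = ≤-refl
... | false = z≤n

+-≡ᵇ-∸ : ∀ r {c k} → c ≤ k → (r + c ≡ᵇ k) ≡ (r ≡ᵇ k ∸ c)
+-≡ᵇ-∸ r {c} {k} c≤k = T-ext
  (λ h → ≡⇒≡ᵇ r (k ∸ c) (trans (sym (m+n∸n≡m r c)) (cong (_∸ c) (≡ᵇ⇒≡ (r + c) k h))))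
  (λ h → ≡⇒≡ᵇ (r + c) k (trans (cong (_+ c) (≡ᵇ⇒≡ r (k ∸ c) h)) (m∸n+n≡m c≤k)))

+-≡ᵇ-> : ∀ r {c k} → k < c → (r + c ≡ᵇ k) ≡ false
+-≡ᵇ-> r {c} {k} k<c = T-ext {y = false}
  (λ h → <⇒≱ k<c (≤-trans (m≤n+m c r) (≤-reflexive (≡ᵇ⇒≡ (r + c) k h)))) λ ()

hasRecordSum-∷ʳ : ∀ k τ a → (if hasRecordSum k (τ ++ a ∷ []) then 1 else 0) ≡
                  (if notElem a τ then (if distinct τ ∧ (recordPosSum τ + recordBonus a τ ≡ᵇ k) then 1 else 0) else 0)
hasRecordSum-∷ʳ k τ a = begin
    (if distinct (τ ++ a ∷ []) ∧ (recordPosSum (τ ++ a ∷ []) ≡ᵇ k) then 1 else 0)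
  ≡⟨ cong₂ (λ d r → if d ∧ (r ≡ᵇ k) then 1 else 0) (distinct-∷ʳ τ a) (recordPosSum-∷ʳ τ a) ⟩
    (if (notElem a τ ∧ distinct τ) ∧ (recordPosSum τ + recordBonus a τ ≡ᵇ k) then 1 else 0)
  ≡⟨ cong (λ b → if b then 1 else 0) (∧-assoc (notElem a τ) _ _) ⟩
    (if notElem a τ ∧ (distinct τ ∧ (recordPosSum τ + recordBonus a τ ≡ᵇ k)) then 1 else 0)
  ≡⟨ if-∧ (notElem a τ) _ ⟩
    (if notElem a τ then (if distinct τ ∧ (recordPosSum τ + recordBonus a τ ≡ᵇ k) then 1 else 0) else 0)
  ∎
  where open ≡-Reasoning

count-hasRecordSum-+ : ∀ c k xs → count (λ τ → distinct τ ∧ (recordPosSum τ + c ≡ᵇ k)) xs ≡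
                                  (if c ≤ᵇ k then count (hasRecordSum (k ∸ c)) xs else 0)
count-hasRecordSum-+ c k xs with c ≤? k
... | yes c≤k = trans (count-cong xs (λ τ _ → cong (distinct τ ∧_) (+-≡ᵇ-∸ (recordPosSum τ) c≤k)))
                      (sym (if-≤ᵇ-yes c≤k))
... | no  c≰k = trans (count-none _ xs (λ τ _ → trans (cong (distinct τ ∧_) (+-≡ᵇ-> (recordPosSum τ) (≰⇒> c≰k)))
                                                      (∧-zeroʳ (distinct τ))))
                      (sym (if-≤ᵇ-no (≰⇒> c≰k)))

-- Stated for any duplicate-free alphabet V, so that removing the last letter stays inside the statement.
RecordCountFormula : ℕ → Set
RecordCountFormula m = ∀ V → T (distinct V) → length V ≡ m → ∀ k → count (hasRecordSum k) (words V m) ≡ recordCount m k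

count-words-lastLetter : ∀ m → RecordCountFormula m → ∀ {V a} k → T (distinct V) → length V ≡ suc m → a ∈ V →
  count (λ τ → distinct τ ∧ (recordPosSum τ + recordBonus a τ ≡ᵇ k)) (words (remove a V) m) ≡
  (if allBelow a (remove a V) then (if suc m ≤ᵇ k then recordCount m (k ∸ suc m) else 0) else recordCount m k)
count-words-lastLetter m formula {V} {a} k dist ∣V∣ a∈V = begin
    count (λ τ → distinct τ ∧ (recordPosSum τ + recordBonus a τ ≡ᵇ k)) (words W m)
  ≡⟨ sumOver-words-cong W m bonusIsConstant ⟩
    count (λ τ → distinct τ ∧ (recordPosSum τ + bonus (allBelow a W) ≡ᵇ k)) (words W m)
  ≡⟨ count-hasRecordSum-+ (bonus (allBelow a W)) k (words W m) ⟩
    (if bonus (allBelow a W) ≤ᵇ k then count (hasRecordSum (k ∸ bonus (allBelow a W))) (words W m) else 0)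
  ≡⟨ cong (λ t → if bonus (allBelow a W) ≤ᵇ k then t else 0)
          (formula W (remove-distinct a V dist) ∣W∣ (k ∸ bonus (allBelow a W))) ⟩
    (if bonus (allBelow a W) ≤ᵇ k then recordCount m (k ∸ bonus (allBelow a W)) else 0)
  ≡⟨ byBelow (allBelow a W) ⟩
    (if allBelow a W then (if suc m ≤ᵇ k then recordCount m (k ∸ suc m) else 0) else recordCount m k)
  ∎
  where
  open ≡-Reasoning
  W = remove a V
  ∣W∣ : length W ≡ m
  ∣W∣ = suc-injective (trans (length-remove-distinct V dist a∈V) ∣V∣)
  bonus : Bool → ℕ
  bonus below = if below then suc m else 0
  bonusIsConstant : ∀ τ → All (_∈ W) τ → length τ ≡ m →
    (if distinct τ ∧ (recordPosSum τ + recordBonus a τ ≡ᵇ k) then 1 else 0) ≡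
    (if distinct τ ∧ (recordPosSum τ + bonus (allBelow a W) ≡ᵇ k) then 1 else 0)
  bonusIsConstant τ τ⊆W ∣τ∣ with distinct τ in distτ
  ... | false = refl
  ... | true  = cong (λ b → if recordPosSum τ + b ≡ᵇ k then 1 else 0)
                  (trans (recordBonus-⊆ a (subst T (sym distτ) _) τ⊆W (trans ∣τ∣ (sym ∣W∣)))
                         (cong (λ l → if allBelow a W then suc l else 0) ∣W∣))
  byBelow : ∀ b → (if bonus b ≤ᵇ k then recordCount m (k ∸ bonus b) else 0) ≡
                  (if b then (if suc m ≤ᵇ k then recordCount m (k ∸ suc m) else 0) else recordCount m k)
  byBelow true  = refl
  byBelow false = refl

count-words-hasRecordSum : ∀ m → RecordCountFormula m
count-words-hasRecordSum zero    [] _ _ zero    = refl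
count-words-hasRecordSum zero    [] _ _ (suc k) = refl
count-words-hasRecordSum (suc m) V@(x ∷ V′) dist ∣V∣ k = begin
    count (hasRecordSum k) (words V (suc m))
  ≡⟨ sumOver-words-∷ʳ _ V m ⟩
    sumOver (λ a → count (λ τ → hasRecordSum k (τ ++ a ∷ [])) (words V m)) V
  ≡⟨ sumOver-cong V (λ a _ → sumOver-cong (words V m) (λ τ _ → hasRecordSum-∷ʳ k τ a)) ⟩
    sumOver (λ a → sumOver (λ τ → if notElem a τ then (if withBonus a τ then 1 else 0) else 0) (words V m)) V
  ≡⟨ sumOver-cong V (λ a _ → sumOver-words-avoiding a V m _) ⟩
    sumOver (λ a → count (withBonus a) (words (remove a V) m)) V
  ≡⟨ sumOver-cong V (λ a a∈V → count-words-lastLetter m (count-words-hasRecordSum m) k dist ∣V∣ a∈V) ⟩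
    sumOver (λ a → if allBelow a (remove a V) then X else Y) V
  ≡⟨ +-cancelʳ-≡ Y _ _ (trans (sumOver-if-one _ X Y V (count-maximal x V′ dist))
       (trans (cong (λ l → X + l * Y) ∣V∣) (x∙yz≈xz∙y X Y (m * Y)))) ⟩
    X + m * Y
  ∎
  where
  open ≡-Reasoning
  X = if suc m ≤ᵇ k then recordCount m (k ∸ suc m) else 0
  Y = recordCount m k
  withBonus : ℕ → List ℕ → Bool
  withBonus a τ = distinct τ ∧ (recordPosSum τ + recordBonus a τ ≡ᵇ k)

length-filter-filter : ∀ {A : Set} {P Q : Pred A 0ℓ} (P? : Decidable P) (Q? : Decidable Q) xs →
                       length (filter P? (filter Q? xs)) ≡ count (λ x → does (Q? x) ∧ does (P? x)) xs
length-filter-filter P? Q? [] = refl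
length-filter-filter P? Q? (x ∷ xs) with does (Q? x)
... | false = length-filter-filter P? Q? xs
... | true with does (P? x)
...   | true  = cong suc (length-filter-filter P? Q? xs)
...   | false = length-filter-filter P? Q? xs

does-≟-true : ∀ b → does (b Bool.≟ true) ≡ b
does-≟-true true  = refl
does-≟-true false = refl

seqs≡words : ∀ n l → seqs n l ≡ words (map suc (upTo n)) l
seqs≡words n zero    = refl
seqs≡words n (suc l) = cong (λ ws → concatMap (λ a → map (a ∷_) ws) (map suc (upTo n))) (seqs≡words n l)

distinct-applyUpTo : ∀ f n → (∀ {i j} → i < j → f i < f j) → T (distinct (applyUpTo f n))
distinct-applyUpTo f zero    _    = _
distinct-applyUpTo f (suc n) mono = Equivalence.from T-∧
  (∉⇒notElem (f 0) _ f0∉ , distinct-applyUpTo (f ∘ suc) n (mono ∘ s≤s))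
  where
  f0∉ : f 0 ∉ applyUpTo (f ∘ suc) n
  f0∉ mem with i , _ , f0≡ ← ∈-applyUpTo⁻ (f ∘ suc) mem = <-irrefl f0≡ (mono z<s)

𝒞≡recordCount : ∀ n k → 𝒞 n k ≡ recordCount n k
𝒞≡recordCount n k = begin
    𝒞 n k
  ≡⟨ length-filter-filter _ _ (seqs n n) ⟩
    count (λ σ → does (distinct σ Bool.≟ true) ∧ (recordPosSum σ ≡ᵇ k)) (seqs n n)
  ≡⟨ count-cong (seqs n n) (λ σ _ → cong (_∧ (recordPosSum σ ≡ᵇ k)) (does-≟-true (distinct σ))) ⟩
    count (hasRecordSum k) (seqs n n)
  ≡⟨ cong (count (hasRecordSum k)) (seqs≡words n n) ⟩
    count (hasRecordSum k) (words alphabet n)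
  ≡⟨ count-words-hasRecordSum n alphabet distinctAlphabet (trans (length-map suc (upTo n)) (length-applyUpTo (λ i → i) n)) k ⟩
    recordCount n k
  ∎
  where
  open ≡-Reasoning
  alphabet = map suc (upTo n)
  distinctAlphabet : T (distinct alphabet)
  distinctAlphabet = subst (T ∘ distinct) (sym (map-upTo suc n)) (distinct-applyUpTo suc n s≤s)

-- Triangular numbers and non-record sums

tri : ℕ → ℕ
tri zero    = 0
tri (suc n) = suc n + tri n

tri-mono-≤ : ∀ {m n} → m ≤ n → tri m ≤ tri n
tri-mono-≤ z≤n       = z≤n
tri-mono-≤ (s≤s m≤n) = +-mono-≤ (s≤s m≤n) (tri-mono-≤ m≤n)

tri-cancel-< : ∀ {m n} → tri m < tri n → m < n
tri-cancel-< {m} {n} lt = ≰⇒> λ n≤m → <⇒≱ lt (tri-mono-≤ n≤m)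

2*tri : ∀ n → 2 * tri n ≡ n * suc n
2*tri zero    = refl
2*tri (suc n) = begin
  2 * (suc n + tri n)       ≡⟨ *-distribˡ-+ 2 (suc n) (tri n) ⟩
  2 * suc n + 2 * tri n     ≡⟨ cong (2 * suc n +_) (2*tri n) ⟩
  2 * suc n + n * suc n     ≡⟨ *-distribʳ-+ (suc n) 2 n ⟨
  suc (suc n) * suc n       ≡⟨ *-comm (suc (suc n)) (suc n) ⟩
  suc n * suc (suc n)       ∎
  where open ≡-Reasoning

S+tri : ∀ {n} i m → suc i + m ≡ n → S n i + tri m ≡ tri n
S+tri zero    m refl = refl
S+tri {n} (suc i) m n≡ = begin
    S n i + (n ∸ suc i) + tri m   ≡⟨ cong (λ t → S n i + t + tri m) n∸[1+i]≡1+m ⟩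
    S n i + suc m + tri m         ≡⟨ +-assoc (S n i) (suc m) (tri m) ⟩
    S n i + tri (suc m)           ≡⟨ S+tri i (suc m) (trans (cong suc (+-suc i m)) n≡) ⟩
    tri n                         ∎
  where
  open ≡-Reasoning
  n∸[1+i]≡1+m : n ∸ suc i ≡ suc m
  n∸[1+i]≡1+m = trans (cong (_∸ suc i) (trans (sym n≡) (cong suc (sym (+-suc i m))))) (m+n∸m≡n (suc i) (suc m))

triangular-decomposition : ∀ b → ∃ λ q → ∃ λ z → z ≤ q × tri q + z ≡ b
triangular-decomposition zero = 0 , 0 , z≤n , refl
triangular-decomposition (suc b) with q , z , z≤q , eq ← triangular-decomposition b with z <? q
... | yes z<q = q , suc z , z<q , trans (+-suc (tri q) z) (cong suc eq)
... | no  z≮q = suc q , 0 , z≤n , (begin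
    suc q + tri q + 0  ≡⟨ +-identityʳ _ ⟩
    suc (q + tri q)    ≡⟨ cong suc (+-comm q (tri q)) ⟩
    suc (tri q + q)    ≡⟨ cong (λ t → suc (tri q + t)) (≤-antisym z≤q (≮⇒≥ z≮q)) ⟨
    suc (tri q + z)    ≡⟨ cong suc eq ⟩
    suc b              ∎)
  where open ≡-Reasoning

-- Permutations of {1,…,m} counted by the sum w of their non-record positions:
-- the coefficient of q^w in ∏_{j≤m} (1 + (j−1) q^j).
nonRecordCount : ℕ → ℕ → ℕ
nonRecordCount zero    zero    = 1
nonRecordCount zero    (suc w) = 0
nonRecordCount (suc m) w = nonRecordCount m w + (if suc m ≤ᵇ w then m * nonRecordCount m (w ∸ suc m) else 0)

nonRecordCount-suc-< : ∀ {m w} → w < suc m → nonRecordCount (suc m) w ≡ nonRecordCount m w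
nonRecordCount-suc-< {m} {w} w<m = trans (cong (nonRecordCount m w +_) (if-≤ᵇ-no w<m)) (+-identityʳ _)

nonRecordCount-suc-+ : ∀ m v → nonRecordCount (suc m) (suc m + v) ≡ nonRecordCount m (suc m + v) + m * nonRecordCount m v
nonRecordCount-suc-+ m v =
  cong (nonRecordCount m (suc m + v) +_) (trans (if-≤ᵇ-yes (m≤m+n (suc m) v)) (cong (λ u → m * nonRecordCount m u) (m+n∸m≡n (suc m) v)))

nonRecordCount-suc-≤ : ∀ m w → nonRecordCount (suc m) w ≤ nonRecordCount m w + m * nonRecordCount m (w ∸ suc m)
nonRecordCount-suc-≤ m w = +-monoʳ-≤ (nonRecordCount m w) (if-≤ᵇ-≤ (suc m) w _)

nonRecordCount-vanishes : ∀ n {w} → tri n < w → nonRecordCount n w ≡ 0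
nonRecordCount-vanishes zero    {suc w} _ = refl
nonRecordCount-vanishes (suc m) {w} tri<w with suc m ≤? w
... | no  w≱ = trans (nonRecordCount-suc-< (≰⇒> w≱)) (nonRecordCount-vanishes m (≤-<-trans (m≤n+m (tri m) (suc m)) tri<w))
... | yes w≥ with v , refl ← m≤n⇒∃[o]m+o≡n w≥ = begin
    nonRecordCount (suc m) (suc m + v)                           ≡⟨ nonRecordCount-suc-+ m v ⟩
    nonRecordCount m (suc m + v) + m * nonRecordCount m v         ≡⟨ cong₂ (λ a b → a + m * b)
                                                                     (nonRecordCount-vanishes m (≤-<-trans (m≤n+m (tri m) (suc m)) tri<w))
                                                                     (nonRecordCount-vanishes m (+-cancelˡ-< (suc m) (tri m) v tri<w)) ⟩
    0 + m * 0                                                    ≡⟨ *-zeroʳ m ⟩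
    0                                                            ∎
  where open ≡-Reasoning

recordCount-vanishes : ∀ n {k} → tri n < k → recordCount n k ≡ 0
recordCount-vanishes zero    {suc k} _ = refl
recordCount-vanishes (suc m) {k} tri<k = cong₂ _+_ recordTerm (trans (cong (m *_) (recordCount-vanishes m tri<k′)) (*-zeroʳ m))
  where
  tri<k′ : tri m < k
  tri<k′ = ≤-<-trans (m≤n+m (tri m) (suc m)) tri<k
  recordTerm : (if suc m ≤ᵇ k then recordCount m (k ∸ suc m) else 0) ≡ 0
  recordTerm with suc m ≤? k
  ... | no  k≱ = if-≤ᵇ-no (≰⇒> k≱)
  ... | yes k≥ with v , refl ← m≤n⇒∃[o]m+o≡n k≥ =
    trans (if-≤ᵇ-yes k≥) (trans (cong (recordCount m) (m+n∸m≡n (suc m) v)) (recordCount-vanishes m (+-cancelˡ-< (suc m) (tri m) v tri<k)))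

recordCount≡nonRecordCount : ∀ n {k w} → k + w ≡ tri n → recordCount n k ≡ nonRecordCount n w
recordCount≡nonRecordCount zero {zero} {zero} _ = refl
recordCount≡nonRecordCount (suc m) {k} {w} k+w≡ = cong₂ _+_ recordTerm nonRecordTerm
  where
  below : ∀ {a b} → a < suc m → a + b ≡ suc m + tri m → tri m < b
  below {a} {b} a≤m a+b≡ = +-cancelˡ-≤ m _ _ (begin
    m + suc (tri m)  ≡⟨ +-suc m (tri m) ⟩
    suc m + tri m    ≡⟨ a+b≡ ⟨
    a + b            ≤⟨ +-monoˡ-≤ b (≤-pred a≤m) ⟩
    m + b            ∎)
    where open ≤-Reasoning
  peel : ∀ {b} v → suc m + v + b ≡ suc m + tri m → v + b ≡ tri m
  peel {b} v eq = +-cancelˡ-≡ (suc m) _ _ (trans (sym (+-assoc (suc m) v b)) eq)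
  recordTerm : (if suc m ≤ᵇ k then recordCount m (k ∸ suc m) else 0) ≡ nonRecordCount m w
  recordTerm with suc m ≤? k
  ... | no  k≱ = trans (if-≤ᵇ-no (≰⇒> k≱)) (sym (nonRecordCount-vanishes m (below (≰⇒> k≱) k+w≡)))
  ... | yes k≥ = trans (if-≤ᵇ-yes k≥)
                   (recordCount≡nonRecordCount m (peel (k ∸ suc m) (trans (cong (_+ w) (m+[n∸m]≡n k≥)) k+w≡)))
  nonRecordTerm : m * recordCount m k ≡ (if suc m ≤ᵇ w then m * nonRecordCount m (w ∸ suc m) else 0)
  nonRecordTerm with suc m ≤? w
  ... | no  w≱ = trans (cong (m *_) (recordCount-vanishes m (below (≰⇒> w≱) (trans (+-comm w k) k+w≡))))
                       (trans (*-zeroʳ m) (sym (if-≤ᵇ-no (≰⇒> w≱))))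
  ... | yes w≥ = trans (cong (m *_) (recordCount≡nonRecordCount m (trans (+-comm k _)
                         (peel (w ∸ suc m) (trans (cong (_+ k) (m+[n∸m]≡n w≥)) (trans (+-comm w k) k+w≡))))))
                       (sym (if-≤ᵇ-yes w≥))

-- The upper bound

!-mono-≤ : ∀ {m n} → m ≤ n → m ! ≤ n !
!-mono-≤ {m} {n} m≤n = ∣⇒≤ {{n !≢0}} (m≤n⇒m!∣n! m≤n)

n*[n∸1]!≤n! : ∀ n → n * (n ∸ 1) ! ≤ n !
n*[n∸1]!≤n! zero    = z≤n
n*[n∸1]!≤n! (suc n) = ≤-refl

nonRecordCount≤2^n*[n∸1]! : ∀ n w → nonRecordCount n w ≤ 2 ^ n * (n ∸ 1) !
nonRecordCount≤2^n*[n∸1]! zero    zero    = ≤-refl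
nonRecordCount≤2^n*[n∸1]! zero    (suc w) = z≤n
nonRecordCount≤2^n*[n∸1]! (suc m) w = begin
    nonRecordCount (suc m) w                                  ≤⟨ nonRecordCount-suc-≤ m w ⟩
    nonRecordCount m w + m * nonRecordCount m (w ∸ suc m)     ≤⟨ +-mono-≤ (nonRecordCount≤2^n*[n∸1]! m w)
                                                                   (*-monoʳ-≤ m (nonRecordCount≤2^n*[n∸1]! m (w ∸ suc m))) ⟩
    B + m * B                                                 ≡⟨ *-x∙yz≈y∙xz (suc m) (2 ^ m) ((m ∸ 1) !) ⟩
    2 ^ m * (suc m * (m ∸ 1) !)                               ≤⟨ *-monoʳ-≤ (2 ^ m) (suc[m]*[m∸1]!≤2*m! m) ⟩
    2 ^ m * (2 * m !)                                         ≡⟨ *-x∙yz≈y∙xz (2 ^ m) 2 (m !) ⟩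
    2 * (2 ^ m * m !)                                         ≡⟨ *-assoc 2 (2 ^ m) (m !) ⟨
    2 ^ suc m * m !                                           ∎
  where
  open ≤-Reasoning
  B = 2 ^ m * (m ∸ 1) !
  suc[m]*[m∸1]!≤2*m! : ∀ m → suc m * (m ∸ 1) ! ≤ 2 * m !
  suc[m]*[m∸1]!≤2*m! zero    = s≤s z≤n
  suc[m]*[m∸1]!≤2*m! (suc m) = +-mono-≤ (m≤m+n (m !) (m * m !)) (m≤m+n (suc m !) 0)

+-witness⇒≤ : ∀ {a b} c → a + c ≡ b → a ≤ b
+-witness⇒≤ {a} c eq = subst (a ≤_) eq (m≤m+n a c)

-- m = p + 2 + e and p = z + t force y = z + e + 2.
drop-level : ∀ {m p y z} → suc p < m → z ≤ p → y + suc p ≡ suc m + z → m * suc z ≤ suc p * suc y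
drop-level {y = y} {z} sp<m z≤p eq
  with e , refl ← m≤n⇒∃[o]m+o≡n sp<m
  with t , refl ← m≤n⇒∃[o]m+o≡n z≤p
  with refl ← +-cancelʳ-≡ (suc (z + t)) y (z + e + 2) (trans eq (solve (z ∷ t ∷ e ∷ []))) =
  +-witness⇒≤ (z + t * (e + 2) + 1) (solve (z ∷ t ∷ e ∷ []))

factorial-gap-base : ∀ {z e a} → tri (z + e) + a + suc z ≡ tri (2 + (z + e)) →
                     a * ((z + e) ! * suc z) ≤ (2 + (z + e)) !
factorial-gap-base {z} {e} {a} eq = begin
    a * (F * suc z)                      ≡⟨ cong (_* (F * suc z)) a≡ ⟩
    (z + e + e + 2) * (F * suc z)        ≡⟨ *-x∙yz≈y∙xz (z + e + e + 2) F (suc z) ⟩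
    F * ((z + e + e + 2) * suc z)        ≤⟨ *-monoʳ-≤ F factor≤ ⟩
    F * ((2 + (z + e)) * (1 + (z + e)))  ≡⟨ *-comm F _ ⟩
    (2 + (z + e)) * (1 + (z + e)) * F    ≡⟨ *-assoc (2 + (z + e)) (1 + (z + e)) F ⟩
    (2 + (z + e)) !                      ∎
  where
  open ≤-Reasoning
  F = (z + e) !
  factor≤ : (z + e + e + 2) * suc z ≤ (2 + (z + e)) * (1 + (z + e))
  factor≤ = +-witness⇒≤ (e * e + e) (product z e)
    where
    product : ∀ z e → (z + e + e + 2) * suc z + (e * e + e) ≡ (2 + (z + e)) * (1 + (z + e))
    product = solve-∀
  a≡ : a ≡ z + e + e + 2
  a≡ = +-cancelˡ-≡ (tri (z + e) + suc z) _ _ (trans (swap (tri (z + e)) a z) (trans eq (expand (tri (z + e)) z e)))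
    where
    swap : ∀ T a z → T + suc z + a ≡ T + a + suc z
    swap = solve-∀
    expand : ∀ T z e → 2 + (z + e) + (1 + (z + e) + T) ≡ T + suc z + (z + e + e + 2)
    expand = solve-∀

suc[n]*[1+q]!≤n*n! : ∀ {q n} → suc (suc q) ≤ n → suc n * suc q ! ≤ n * n !
suc[n]*[1+q]!≤n*n! {q} {suc (suc r)} (s≤s sq≤r) = begin
    suc (suc (suc r)) * suc q !           ≤⟨ *-monoʳ-≤ (suc (suc (suc r))) (!-mono-≤ sq≤r) ⟩
    suc (suc (suc r)) * suc r !           ≤⟨ *-monoˡ-≤ (suc r !) 3+r≤[2+r]² ⟩
    suc (suc r) * suc (suc r) * suc r !   ≡⟨ *-assoc (suc (suc r)) (suc (suc r)) (suc r !) ⟩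
    suc (suc r) * suc (suc r) !           ∎
  where
  open ≤-Reasoning
  3+r≤[2+r]² : 3 + r ≤ (2 + r) * (2 + r)
  3+r≤[2+r]² = +-witness⇒≤ (r * r + 3 * r + 1) (square r)
    where
    square : ∀ r → 3 + r + (r * r + 3 * r + 1) ≡ (2 + r) * (2 + r)
    square = solve-∀

interpolated≤[1+q]! : ∀ {q z} → z ≤ q → q ! * suc z ≤ suc q !
interpolated≤[1+q]! {q} z≤q = ≤-trans (*-monoʳ-≤ (q !) (s≤s z≤q)) (≤-reflexive (*-comm (q !) (suc q)))

factorial-gap : ∀ {q z a p} → z ≤ q → suc (suc q) ≤′ p → tri q + a + suc z ≡ tri p → a * (q ! * suc z) ≤ p !
factorial-gap z≤q ≤′-refl eq with _ , refl ← m≤n⇒∃[o]m+o≡n z≤q = factorial-gap-base eq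
factorial-gap {q} {z} {a} {suc p} z≤q (≤′-step sq<p) eq = begin
    a * P                   ≡⟨ cong (_* P) a≡ ⟩
    (suc p + a₀) * P        ≡⟨ *-distribʳ-+ P (suc p) a₀ ⟩
    suc p * P + a₀ * P      ≤⟨ +-mono-≤ (≤-trans (*-monoʳ-≤ (suc p) (interpolated≤[1+q]! z≤q)) (suc[n]*[1+q]!≤n*n! (≤′⇒≤ sq<p)))
                                        (factorial-gap z≤q sq<p eq₀) ⟩
    p * p ! + p !           ≡⟨ +-comm (p * p !) (p !) ⟩
    suc p !                 ∎
  where
  open ≤-Reasoning
  P = q ! * suc z
  below : tri q + suc z ≤ tri p
  below = ≤-trans (+-monoʳ-≤ (tri q) (s≤s z≤q))
                  (≤-trans (≤-reflexive (+-comm (tri q) (suc q))) (tri-mono-≤ (≤-trans (n≤1+n (suc q)) (≤′⇒≤ sq<p))))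
  regroup : ∀ T a z → T + a + suc z ≡ a + (T + suc z)
  regroup = solve-∀
  sp≤a : suc p ≤ a
  sp≤a = +-cancelʳ-≤ (tri q + suc z) (suc p) a
           (≤-trans (+-monoʳ-≤ (suc p) below) (≤-reflexive (trans (sym eq) (regroup (tri q) a z))))
  a₀ = a ∸ suc p
  a≡ : a ≡ suc p + a₀
  a≡ = sym (m+[n∸m]≡n sp≤a)
  eq₀ : tri q + a₀ + suc z ≡ tri p
  eq₀ = +-cancelˡ-≡ (suc p) _ _ (trans (pull (tri q) (suc p) a₀ z) (trans (cong (λ x → tri q + x + suc z) (sym a≡)) eq))
    where
    pull : ∀ T s a₀ z → s + (T + a₀ + suc z) ≡ T + (s + a₀) + suc z
    pull = solve-∀

-- With m = y + a and a ≥ p: a · q ! · (z+1) ≤ p ! by factorial-gap, and y · q ! · (z+1) ≤ y · p !.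
jump-level : ∀ {m p y q z} → z ≤ q → y + p ≤ m → suc m + (tri q + z) ≡ tri p + y →
             m * (q ! * suc z) ≤ p ! * suc y
jump-level {p = p} {y} {q} {z} z≤q y+p≤m eq with a , refl ← m≤n⇒∃[o]m+o≡n (≤-trans (m≤m+n y _) y+p≤m) =
  gapped (+-cancelˡ-≤ y _ a y+p≤m) eqₐ
  where
  shuffle : ∀ T y a z → suc (y + a) + (T + z) ≡ T + a + suc z + y
  shuffle = solve-∀
  eqₐ : tri q + a + suc z ≡ tri p
  eqₐ = +-cancelʳ-≡ y _ _ (trans (sym (shuffle (tri q) y a z)) eq)
  gapped : ∀ {p} → p ≤ a → tri q + a + suc z ≡ tri p → (y + a) * (q ! * suc z) ≤ p ! * suc y
  gapped {zero}  _   eq′ = ⊥-elim (m+1+n≢0 (tri q + a) eq′)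
  gapped {suc p} p<a eq′ = begin
      (y + a) * P            ≡⟨ *-distribʳ-+ P y a ⟩
      y * P + a * P          ≤⟨ +-mono-≤ (*-monoʳ-≤ y (≤-trans (interpolated≤[1+q]! z≤q) (!-mono-≤ (<⇒≤ q<p))))
                                         (factorial-gap z≤q (≤⇒≤′ q<p) eq′) ⟩
      y * suc p ! + suc p !  ≡⟨ +-comm (y * suc p !) (suc p !) ⟩
      suc p ! + y * suc p !  ≡⟨ cong (suc p ! +_) (*-comm y (suc p !)) ⟩
      suc p ! + suc p ! * y  ≡⟨ *-suc (suc p !) y ⟨
      suc p ! * suc y        ∎
    where
    open ≤-Reasoning
    P = q ! * suc z
    below : tri q + suc z ≤ tri p
    below = +-cancelˡ-≤ (suc p) _ _ (begin
      suc p + (tri q + suc z)  ≤⟨ +-monoˡ-≤ (tri q + suc z) p<a ⟩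
      a + (tri q + suc z)      ≡⟨ trans (x∙yz≈y∙xz a (tri q) (suc z)) (sym (+-assoc (tri q) a (suc z))) ⟩
      tri q + a + suc z        ≡⟨ eq′ ⟩
      suc p + tri p            ∎)
    q<p : suc q < suc p
    q<p = s≤s (tri-cancel-< (<-≤-trans (m<m+n (tri q) z<s) below))

-- p ! * suc y runs linearly from p ! to (p+1)! as the budget tri p + y crosses [tri p, tri (p+1));
-- the plain bound c ! for w < tri c does not survive the induction.
InterpolatedBound : ℕ → Set
InterpolatedBound n = ∀ {w p y} → y ≤ p → w < tri p + y → nonRecordCount n w ≤ 2 ^ n * (p ! * suc y)

nonRecordTerm≤ : ∀ {m v p y} q z → InterpolatedBound m → z ≤ q → v < tri q + z → m * (q ! * suc z) ≤ p ! * suc y →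
                 m * nonRecordCount m v ≤ 2 ^ m * (p ! * suc y)
nonRecordTerm≤ {m} {v} {p} {y} q z bound z≤q v< m*bound≤ = begin
    m * nonRecordCount m v       ≤⟨ *-monoʳ-≤ m (bound z≤q v<) ⟩
    m * (2 ^ m * (q ! * suc z))  ≡⟨ *-x∙yz≈y∙xz m (2 ^ m) _ ⟩
    2 ^ m * (m * (q ! * suc z))  ≤⟨ *-monoʳ-≤ (2 ^ m) m*bound≤ ⟩
    2 ^ m * (p ! * suc y)        ∎
  where open ≤-Reasoning

nonRecordStep-drop : ∀ {m v p y} → InterpolatedBound m → y ≤ suc p → suc p < m → suc m ≤ y + suc p →
                     suc m + v < tri (suc p) + y → m * nonRecordCount m v ≤ 2 ^ m * (suc p ! * suc y)
nonRecordStep-drop {m} {v} {p} {y} bound y≤p p<m m<y+p v< = nonRecordTerm≤ {m} {v} {suc p} {y} p z bound z≤p v<′ (begin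
    m * (p ! * suc z)       ≡⟨ *-x∙yz≈y∙xz m (p !) (suc z) ⟩
    p ! * (m * suc z)       ≤⟨ *-monoʳ-≤ (p !) (drop-level p<m z≤p (sym z≡)) ⟩
    p ! * (suc p * suc y)   ≡⟨ *-x∙yz≈y∙xz (p !) (suc p) (suc y) ⟩
    suc p * (p ! * suc y)   ≡⟨ *-assoc (suc p) (p !) (suc y) ⟨
    suc p ! * suc y         ∎)
  where
  open ≤-Reasoning
  z = y + suc p ∸ suc m
  z≡ : suc m + z ≡ y + suc p
  z≡ = m+[n∸m]≡n m<y+p
  z≤p : z ≤ p
  z≤p = +-cancelˡ-≤ (suc m) z p (begin
    suc m + z       ≡⟨ z≡ ⟩
    y + suc p       ≤⟨ +-monoˡ-≤ (suc p) (≤-trans y≤p (<⇒≤ p<m)) ⟩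
    m + suc p       ≡⟨ +-suc m p ⟩
    suc m + p       ∎)
  v<′ : v < tri p + z
  v<′ = +-cancelˡ-< (suc m) v _ (<-≤-trans v< (≤-reflexive (begin-equality
    suc p + tri p + y      ≡⟨ regroup (suc p) (tri p) y ⟩
    tri p + (y + suc p)    ≡⟨ cong (tri p +_) z≡ ⟨
    tri p + (suc m + z)    ≡⟨ x∙yz≈y∙xz (tri p) (suc m) z ⟩
    suc m + (tri p + z)    ∎)))
    where
    regroup : ∀ s T y → s + T + y ≡ T + (y + s)
    regroup = solve-∀

nonRecordStep-jump : ∀ {m v p y} → InterpolatedBound m → y + p ≤ m → suc m + v < tri p + y →
                     m * nonRecordCount m v ≤ 2 ^ m * (p ! * suc y)
nonRecordStep-jump {m} {v} {p} {y} bound y+p≤m v< =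
  nonRecordTerm≤ {m} {v} {p} {y} q z bound z≤q (+-cancelˡ-< (suc m) v _ (<-≤-trans v< (≤-reflexive (sym b≡))))
                 (jump-level {m} {p} {y} z≤q y+p≤m b≡)
  where
  decomposition = triangular-decomposition (tri p + y ∸ suc m)
  q = proj₁ decomposition
  z = proj₁ (proj₂ decomposition)
  z≤q = proj₁ (proj₂ (proj₂ decomposition))
  b≡ : suc m + (tri q + z) ≡ tri p + y
  b≡ = trans (cong (suc m +_) (proj₂ (proj₂ (proj₂ decomposition)))) (m+[n∸m]≡n (≤-trans (m≤m+n (suc m) v) (<⇒≤ v<)))

-- The budget left after paying m + 1 for position m + 1: for m ≤ p the crude bound suffices;
-- otherwise it is rewritten as tri q + z, with q = p − 1 when m < y + p.
nonRecordStep : ∀ m → InterpolatedBound m →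
                ∀ {v p y} → y ≤ p → suc m + v < tri p + y → m * nonRecordCount m v ≤ 2 ^ m * (p ! * suc y)
nonRecordStep m bound {v} {p} {y} y≤p v< with m ≤? p | suc m ≤? y + p
... | yes m≤p | _ = begin
    m * nonRecordCount m v    ≤⟨ *-monoʳ-≤ m (nonRecordCount≤2^n*[n∸1]! m v) ⟩
    m * (2 ^ m * (m ∸ 1) !)   ≡⟨ *-x∙yz≈y∙xz m (2 ^ m) _ ⟩
    2 ^ m * (m * (m ∸ 1) !)   ≤⟨ *-monoʳ-≤ (2 ^ m) (≤-trans (n*[n∸1]!≤n! m) (≤-trans (!-mono-≤ m≤p) (m≤m*n (p !) (suc y)))) ⟩
    2 ^ m * (p ! * suc y)     ∎
  where open ≤-Reasoning
... | no m≰p | no  y+p≯m = nonRecordStep-jump {m} {v} {p} {y} bound (≤-pred (≰⇒> y+p≯m)) v<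
... | no m≰p | yes y+p>m with p
...   | zero  = ⊥-elim (<⇒≱ (≤-trans y+p>m (≤-trans (≤-reflexive (+-identityʳ y)) y≤p)) z≤n)
...   | suc p = nonRecordStep-drop {m} {v} {p} {y} bound y≤p (≰⇒> m≰p) y+p>m v<

nonRecordCount-interpolatedBound : ∀ n → InterpolatedBound n
nonRecordCount-interpolatedBound zero {w} {p} {y} _ _ =
  ≤-trans (nonRecordCount≤2^n*[n∸1]! zero w) (≤-trans (*-mono-≤ (1≤n! p) (s≤s (z≤n {y}))) (m≤m+n _ 0))
nonRecordCount-interpolatedBound (suc m) {w} {p} {y} y≤p w< with suc m ≤? w
... | no  w≱ = begin
    nonRecordCount (suc m) w       ≡⟨ nonRecordCount-suc-< (≰⇒> w≱) ⟩
    nonRecordCount m w             ≤⟨ nonRecordCount-interpolatedBound m y≤p w< ⟩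
    B                              ≤⟨ m≤m+n B (B + 0) ⟩
    2 * B                          ≡⟨ *-assoc 2 (2 ^ m) _ ⟨
    2 ^ suc m * (p ! * suc y)      ∎
  where
  open ≤-Reasoning
  B = 2 ^ m * (p ! * suc y)
... | yes w≥ with v , refl ← m≤n⇒∃[o]m+o≡n w≥ = begin
    nonRecordCount (suc m) (suc m + v)                     ≡⟨ nonRecordCount-suc-+ m v ⟩
    nonRecordCount m (suc m + v) + m * nonRecordCount m v  ≤⟨ +-mono-≤ (nonRecordCount-interpolatedBound m y≤p w<)
                                                                       (nonRecordStep m (nonRecordCount-interpolatedBound m) y≤p w<) ⟩
    B + B                                                  ≡⟨ cong (B +_) (+-identityʳ B) ⟨
    2 * B                                                  ≡⟨ *-assoc 2 (2 ^ m) _ ⟨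
    2 ^ suc m * (p ! * suc y)                              ∎
  where
  open ≤-Reasoning
  B = 2 ^ m * (p ! * suc y)

-- The lower bound

nonRecordCount-record : ∀ m w → nonRecordCount m w ≤ nonRecordCount (suc m) w
nonRecordCount-record m w = m≤m+n (nonRecordCount m w) _

nonRecordCount-mono : ∀ {m n} w → m ≤′ n → nonRecordCount m w ≤ nonRecordCount n w
nonRecordCount-mono w ≤′-refl        = ≤-refl
nonRecordCount-mono w (≤′-step m≤′n) = ≤-trans (nonRecordCount-mono w m≤′n) (nonRecordCount-record _ w)

nonRecordCount-nonRecord : ∀ m w → m * nonRecordCount m w ≤ nonRecordCount (suc m) (suc m + w)
nonRecordCount-nonRecord m w = ≤-trans (m≤n+m _ _) (≤-reflexive (sym (nonRecordCount-suc-+ m w)))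

nonRecordCount-allNonRecords : ∀ m → m ! ≤ nonRecordCount (suc m) (m + tri m)
nonRecordCount-allNonRecords zero    = ≤-refl
nonRecordCount-allNonRecords (suc m) = begin
    suc m * m !                                           ≤⟨ *-monoʳ-≤ (suc m) (nonRecordCount-allNonRecords m) ⟩
    suc m * nonRecordCount (suc m) (m + tri m)            ≤⟨ nonRecordCount-nonRecord (suc m) (m + tri m) ⟩
    nonRecordCount (suc (suc m)) (suc (suc m) + (m + tri m)) ≡⟨ cong (λ u → nonRecordCount (suc (suc m)) (suc u)) (+-suc m (m + tri m)) ⟨
    nonRecordCount (suc (suc m)) (suc m + tri (suc m))    ∎
  where open ≤-Reasoning

nonRecordCount-allButOne : ∀ {j m w} → suc j ≤′ m → w + suc (suc j) ≡ m + tri m →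
                           m ! ≤ suc j * nonRecordCount (suc m) w
nonRecordCount-allButOne {j} {w = w} ≤′-refl eq = begin
    suc j * j !                                  ≤⟨ *-monoʳ-≤ (suc j) (nonRecordCount-allNonRecords j) ⟩
    suc j * nonRecordCount (suc j) (j + tri j)   ≤⟨ *-monoʳ-≤ (suc j) (nonRecordCount-record (suc j) _) ⟩
    suc j * nonRecordCount (suc (suc j)) (j + tri j) ≡⟨ cong (λ u → suc j * nonRecordCount (suc (suc j)) u) w≡ ⟨
    suc j * nonRecordCount (suc (suc j)) w       ∎
  where
  open ≤-Reasoning
  expand : ∀ j T → suc j + (suc j + T) ≡ j + T + suc (suc j)
  expand = solve-∀
  w≡ : w ≡ j + tri j
  w≡ = +-cancelʳ-≡ (suc (suc j)) w _ (trans eq (expand j (tri j)))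
nonRecordCount-allButOne {j} {suc m} {w} (≤′-step sj≤′m) eq = begin
    suc m * m !                                     ≤⟨ *-monoʳ-≤ (suc m) (nonRecordCount-allButOne sj≤′m eq′) ⟩
    suc m * (suc j * nonRecordCount (suc m) w′)     ≡⟨ *-x∙yz≈y∙xz (suc m) (suc j) _ ⟩
    suc j * (suc m * nonRecordCount (suc m) w′)     ≤⟨ *-monoʳ-≤ (suc j) (nonRecordCount-nonRecord (suc m) w′) ⟩
    suc j * nonRecordCount (suc (suc m)) (suc (suc m) + w′) ≡⟨ cong (λ u → suc j * nonRecordCount (suc (suc m)) u) w≡ ⟨
    suc j * nonRecordCount (suc (suc m)) w          ∎
  where
  open ≤-Reasoning
  sj≤m = ≤′⇒≤ sj≤′m
  gap : suc (suc j) ≤ m + tri m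
  gap = ≤-trans (s≤s sj≤m) (≤-trans (≤-reflexive (+-comm 1 m)) (+-monoʳ-≤ m (1≤tri (≤-trans (s≤s z≤n) sj≤m))))
    where
    1≤tri : ∀ {m} → 1 ≤ m → 1 ≤ tri m
    1≤tri {suc m} _ = s≤s z≤n
  w′ = m + tri m ∸ suc (suc j)
  eq′ : w′ + suc (suc j) ≡ m + tri m
  eq′ = m∸n+n≡m gap
  w≡ : w ≡ suc (suc m) + w′
  w≡ = +-cancelʳ-≡ (suc (suc j)) w _ (begin-equality
    w + suc (suc j)                  ≡⟨ eq ⟩
    suc m + (suc m + tri m)          ≡⟨ cong suc (+-suc m (m + tri m)) ⟩
    suc (suc m) + (m + tri m)        ≡⟨ cong (suc (suc m) +_) eq′ ⟨
    suc (suc m) + (w′ + suc (suc j)) ≡⟨ +-assoc (suc (suc m)) w′ (suc (suc j)) ⟨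
    suc (suc m) + w′ + suc (suc j)   ∎)

nonRecordCount-withoutTwo : ∀ k {w} → w + 2 ≡ suc (2 + k) + tri (2 + k) →
                            (2 + k) ! ≤ suc (2 + k) * nonRecordCount (2 + (2 + k)) w
nonRecordCount-withoutTwo k {w} eq = begin
    m * suc k !                                         ≤⟨ *-monoˡ-≤ (suc k !) (n≤1+n m) ⟩
    suc m * suc k !                                     ≤⟨ *-monoʳ-≤ (suc m) (nonRecordCount-allButOne (≤⇒≤′ (s≤s z≤n)) eq₀) ⟩
    suc m * (1 * nonRecordCount m w₀)                   ≡⟨ cong (suc m *_) (*-identityˡ (nonRecordCount m w₀)) ⟩
    suc m * nonRecordCount m w₀                         ≤⟨ *-monoʳ-≤ (suc m) (nonRecordCount-record m w₀) ⟩
    suc m * nonRecordCount (suc m) w₀                   ≤⟨ nonRecordCount-nonRecord (suc m) w₀ ⟩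
    nonRecordCount (suc (suc m)) (suc (suc m) + w₀)     ≡⟨ cong (nonRecordCount (suc (suc m))) w≡ ⟨
    nonRecordCount (suc (suc m)) w                      ≤⟨ m≤n*m _ (suc m) ⟩
    suc m * nonRecordCount (suc (suc m)) w              ∎
  where
  open ≤-Reasoning
  m = 2 + k
  w₀ = k + (k + tri k)
  eq₀ : w₀ + 2 ≡ suc k + tri (suc k)
  eq₀ = lower k (tri k)
    where
    lower : ∀ k T → k + (k + T) + 2 ≡ suc k + (suc k + T)
    lower = solve-∀
  w≡ : w ≡ suc (suc m) + w₀
  w≡ = +-cancelʳ-≡ 2 w _ (trans eq (upper k (tri k)))
    where
    upper : ∀ k T → suc (2 + k) + (2 + k + (suc k + T)) ≡ suc (suc (2 + k)) + (k + (k + T)) + 2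
    upper = solve-∀

-- With w + r + 1 = tri (m+1): the non-record sets {2,…,m+1}, {2,…,m+1}∖{r} (r ≥ 2) and
-- {3,…,m,m+2} (r = 1).
nonRecordCount-lower : ∀ {m w} → 2 ≤ m → tri m ≤ w → w < tri (suc m) → m ! ≤ suc m * nonRecordCount (suc (suc m)) w
nonRecordCount-lower {m} {w} 2≤m tri≤w w< with r , eq ← m≤n⇒∃[o]m+o≡n w< =
  byMissing r (trans (+-suc w r) eq) r≤m
  where
  r≤m : r ≤ m
  r≤m = ≤-pred (+-cancelˡ-≤ (tri m) _ _ (begin
    tri m + suc r    ≤⟨ +-monoˡ-≤ (suc r) tri≤w ⟩
    w + suc r        ≡⟨ +-suc w r ⟩
    suc w + r        ≡⟨ eq ⟩
    suc m + tri m    ≡⟨ +-comm (suc m) (tri m) ⟩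
    tri m + suc m    ∎))
    where open ≤-Reasoning
  N = nonRecordCount (suc (suc m)) w
  byMissing : ∀ r → w + suc r ≡ suc m + tri m → r ≤ m → m ! ≤ suc m * N
  byMissing zero eq₀ _ = begin
    m !                                  ≤⟨ nonRecordCount-allNonRecords m ⟩
    nonRecordCount (suc m) (m + tri m)   ≡⟨ cong (nonRecordCount (suc m)) (suc-injective (trans (+-comm 1 w) eq₀)) ⟨
    nonRecordCount (suc m) w             ≤⟨ nonRecordCount-record (suc m) w ⟩
    N                                    ≤⟨ m≤n*m N (suc m) ⟩
    suc m * N                            ∎
    where open ≤-Reasoning
  byMissing (suc (suc j)) eq₂ r≤m = begin
    m !                                  ≤⟨ nonRecordCount-allButOne (≤⇒≤′ (≤-trans (n≤1+n (suc j)) r≤m))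
                                              (suc-injective (trans (sym (+-suc w (suc (suc j)))) eq₂)) ⟩
    suc j * nonRecordCount (suc m) w     ≤⟨ *-mono-≤ (≤-trans (n≤1+n (suc j)) (≤-trans r≤m (n≤1+n m))) (nonRecordCount-record (suc m) w) ⟩
    suc m * N                            ∎
    where open ≤-Reasoning
  byMissing (suc zero) eq₁ _ with k , refl ← m≤n⇒∃[o]m+o≡n 2≤m = nonRecordCount-withoutTwo k eq₁

nonRecordCount-bounds : ∀ {n c w} → c < n → n < w → tri (c ∸ 1) ≤ w → w < tri c →
                        (c ! ≤ n * nonRecordCount n w * suc n) × (nonRecordCount n w ≤ 2 ^ n * c !)
nonRecordCount-bounds {n} {c} {w} c<n n<w tri≤w w<tri = lower c c<n tri≤w w<tri , upper
  where
  upper : nonRecordCount n w ≤ 2 ^ n * c !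
  upper = ≤-trans (nonRecordCount-interpolatedBound n {p = c} z≤n (<-≤-trans w<tri (m≤m+n (tri c) 0)))
                  (≤-reflexive (cong (2 ^ n *_) (*-identityʳ (c !))))
  lower : ∀ c → c < n → tri (c ∸ 1) ≤ w → w < tri c → c ! ≤ n * nonRecordCount n w * suc n
  lower 0 _ _ ()
  lower 1 _ _ w<1 = ⊥-elim (<⇒≱ n<w (≤-trans (≤-pred w<1) z≤n))
  lower 2 2<n _ w<3 = ⊥-elim (<⇒≱ 2<n (<⇒≤ (<-≤-trans n<w (≤-pred w<3))))
  lower (suc (suc (suc j))) c<n tri≤w w<tri = begin
      suc m * m !                               ≤⟨ *-monoʳ-≤ (suc m) (nonRecordCount-lower (s≤s (s≤s z≤n)) tri≤w w<tri) ⟩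
      suc m * (suc m * N (suc (suc m)) w)       ≤⟨ *-mono-≤ (<⇒≤ c<n) (*-mono-≤ (≤-trans (<⇒≤ c<n) (n≤1+n n))
                                                     (nonRecordCount-mono w (≤⇒≤′ c<n))) ⟩
      n * (suc n * N n w)                       ≡⟨ cong (n *_) (*-comm (suc n) (N n w)) ⟩
      n * (N n w * suc n)                       ≡⟨ *-assoc n (N n w) (suc n) ⟨
      n * N n w * suc n                         ∎
    where
    open ≤-Reasoning
    m = suc (suc j)
    N = nonRecordCount

k+n<tri[n] : ∀ n k → 2 * k < n * (n ∸ 1) → k + n < tri n
k+n<tri[n] (suc n) k 2k< = begin-strict
    k + suc n      <⟨ +-monoˡ-< (suc n) k<tri ⟩
    tri n + suc n  ≡⟨ +-comm (tri n) (suc n) ⟩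
    tri (suc n)    ∎
  where
  open ≤-Reasoning
  k<tri : k < tri n
  k<tri = *-cancelˡ-< 2 k (tri n) (<-≤-trans 2k< (≤-reflexive (trans (*-comm (suc n) n) (sym (2*tri n)))))

-- tri n ∸ k is the sum of the non-record positions.
𝒞-bounds : ∀ {n k c} → c < n → k + n < tri n → tri n < k + tri c → k + tri (c ∸ 1) ≤ tri n →
           (c ! ≤ n * 𝒞 n k * suc n) × (𝒞 n k ≤ 2 ^ n * c !)
𝒞-bounds {n} {k} {c} c<n k+n< tri< k+tri≤ =
  subst (λ x → (c ! ≤ n * x * suc n) × (x ≤ 2 ^ n * c !)) (sym 𝒞≡nonRecordCount)
    (nonRecordCount-bounds c<n
      (+-cancelˡ-< k n w (<-≤-trans k+n< (≤-reflexive (sym k+w))))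
      (+-cancelˡ-≤ k _ w (≤-trans k+tri≤ (≤-reflexive (sym k+w))))
      (+-cancelˡ-< k w _ (≤-trans (≤-reflexive (cong suc k+w)) tri<)))
  where
  w = tri n ∸ k
  k+w : k + w ≡ tri n
  k+w = m+[n∸m]≡n (≤-trans (m≤m+n k n) (<⇒≤ k+n<))
  𝒞≡nonRecordCount : 𝒞 n k ≡ nonRecordCount n w
  𝒞≡nonRecordCount = trans (𝒞≡recordCount n k) (recordCount≡nonRecordCount n k+w)

1+i+[n∸i∸1]≡n : ∀ {n i} → i < n → suc i + (n ∸ i ∸ 1) ≡ n
1+i+[n∸i∸1]≡n {n} {i} i<n = trans (cong (suc i +_) (trans (∸-+-assoc n i 1) (cong (n ∸_) (+-comm i 1)))) (m+[n∸m]≡n i<n)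

S≤k∸1⇒tri<k+tri : ∀ {n k i} → i < n → 1 ≤ k → S n i ≤ k ∸ 1 → tri n < k + tri (n ∸ i ∸ 1)
S≤k∸1⇒tri<k+tri {n} {k} {i} i<n 1≤k S≤k∸1 = begin-strict
    tri n                   ≡⟨ S+tri i c (1+i+[n∸i∸1]≡n i<n) ⟨
    S n i + tri c           <⟨ +-monoˡ-< (tri c) (<-≤-trans (s≤s S≤k∸1) (≤-reflexive (trans (+-comm 1 (k ∸ 1)) (m∸n+n≡m 1≤k)))) ⟩
    k + tri c               ∎
  where
  open ≤-Reasoning
  c = n ∸ i ∸ 1

maximal⇒k+tri≤tri : ∀ {n k i₀} → i₀ < n → k ≤ tri n → (∀ i → i < n → S n i ≤ k ∸ 1 → i ≤ i₀) →
                    k + tri (n ∸ i₀ ∸ 1 ∸ 1) ≤ tri n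
maximal⇒k+tri≤tri {n} {k} {i₀} i₀<n k≤tri maximal = byRest (n ∸ i₀ ∸ 1) (1+i+[n∸i∸1]≡n i₀<n)
  where
  byRest : ∀ c → suc i₀ + c ≡ n → k + tri (c ∸ 1) ≤ tri n
  byRest zero    _  = ≤-trans (≤-reflexive (+-identityʳ k)) k≤tri
  byRest (suc m) n≡ with k ≤? S n (suc i₀)
  ... | yes k≤S = ≤-trans (+-monoˡ-≤ (tri m) k≤S) (≤-reflexive (S+tri (suc i₀) m (trans (sym (+-suc (suc i₀) m)) n≡)))
  ... | no  k≰S = ⊥-elim (1+n≰n (maximal (suc i₀) 1+i₀<n (∸-monoˡ-≤ 1 (≰⇒> k≰S))))
    where
    1+i₀<n : suc i₀ < n
    1+i₀<n = ≤-trans (s≤s (s≤s (m≤m+n i₀ m))) (≤-reflexive (trans (cong suc (sym (+-suc i₀ m))) n≡))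

expPartialScaled-1 : ∀ x → expPartialScaled x 1 ≡ suc x
expPartialScaled-1 x = expand x
  where
  expand : ∀ x → 1 * 1 + (x * 1 * 1 + 0) ≡ suc x
  expand = solve-∀

proposition4p9 : (n k i₀ : ℕ) → 3 < n → n + 1 ≤ k → 2 * k < n * (n ∸ 1)
    → i₀ < n → S n i₀ ≤ k ∸ 1 → ((i : ℕ) → i < n → S n i ≤ k ∸ 1 → i ≤ i₀)
    → (∃ λ m → ((n ∸ i₀ ∸ 1) !) * (m !) ≤ n * 𝒞 n k * expPartialScaled n m)
    × (𝒞 n k ≤ 2 ^ n * ((n ∸ i₀ ∸ 1) !))
proposition4p9 n k i₀ _ n+1≤k 2k< i₀<n S≤k∸1 maximal = (1 , lower) , proj₂ bounds
  where
  c = n ∸ i₀ ∸ 1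
  k+n<tri = k+n<tri[n] n k 2k<
  bounds = 𝒞-bounds (≤-trans (s≤s (m≤n+m c i₀)) (≤-reflexive (1+i+[n∸i∸1]≡n i₀<n))) k+n<tri
             (S≤k∸1⇒tri<k+tri i₀<n (≤-trans (m≤n+m 1 n) n+1≤k) S≤k∸1)
             (maximal⇒k+tri≤tri i₀<n (≤-trans (m≤m+n k n) (<⇒≤ k+n<tri)) maximal)
  lower : c ! * 1 ! ≤ n * 𝒞 n k * expPartialScaled n 1
  lower = subst₂ _≤_ (sym (*-identityʳ (c !))) (cong (n * 𝒞 n k *_) (sym (expPartialScaled-1 n))) (proj₁ bounds)
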